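{- Let $b,c\in\mathbb{Z}_{\ge1}$, ${\bf n}_0\in N^+_{\mathrm{pr}}$ and $k\in\mathbb{Z}_{\ge1}$. Then \[ \tau^{(b,c)}(k{\bf n}_0)=\sum_{\substack{s_1,\dots,s_k\ge0\\ s_1+2s_2+\cdots+ks_k=k}}\ \prod_{j=1}^k\binom{g({\bf n}_0;b,c)\,U_{j{\bf n}_0}(c,b)}{s_j}. \]
   Context: Fix positive integers $b,c$. Let $N^+=\mathbb{Z}_{\ge0}^2\setminus\{(0,0)\}$, $N^+_{\mathrm{pr}}=\{(n_1,n_2)\in N^+:\gcd(n_1,n_2)=1\}$. For ${\bf n}=(n_1,n_2),{\bf n}'\in N^+$: $\{{\bf n},{\bf n}'\}=n_1n_2'-n_2n_1'$, $\deg({\bf n})=n_1+n_2$, $\delta({\bf n})=\frac{bc}{\gcd(n_1b,n_2c)}$, $g({\bf n};b,c)=\frac{\gcd(n_1b,n_2c)}{\gcd(n_1,n_2)}$; $\binom{x}{k}=\frac{x(x-1)\cdots(x-k+1)}{k!}$. Let $G=\exp(\hat{\mathfrak g})$ where $\hat{\mathfrak g}=\prod_{{\bf n}\in N^+}\mathbb{Q}X_{\bf n}$ with $[X_{\bf n},X_{{\bf n}'}]=\{{\bf n},{\bf n}'\}X_{{\bf n}+{\bf n}'}$, and $\Psi[{\bf n}]^s=\exp(s\sum_{j\ge1}\frac{(-1)^{j+1}}{j^2}X_{j{\bf n}})$. Define $u_{\bf n}(c,b)\in\mathbb{Q}$ by $\Psi[(0,1)]^b\Psi[(1,0)]^c=\overrightarrow{\prod}_{{\bf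 n}\in N^+}\Psi[{\bf n}]^{u_{\bf n}(c,b)}$, the ordered product meaning $\Psi[{\bf n}]$ is left of $\Psi[{\bf n}']$ only if $\{{\bf n},{\bf n}'\}\ge0$, and if $\{{\bf n},{\bf n}'\}=0$ only if $\deg{\bf n}<\deg{\bf n}'$. Put $U_{\bf n}(c,b)=\frac{\gcd(n_1,n_2)}{bc}u_{\bf n}(c,b)$ and $\hat u_{\bf n}=\delta({\bf n})^{ -1}u_{\bf n}$. With $\hat{\bf y}^{\bf n}=\hat y_1^{n_1}\hat y_2^{n_2}$ ($\hat y_1=x_2^{ -b}$, $\hat y_2=x_1^c$), the wall function for ${\bf n}_0\in N^+_{\mathrm{pr}}$ is $f_{{\bf n}_0}=\prod_{k\ge1}(1+\hat{\bf y}^{k{\bf n}_0})^{\hat u_{k{\bf n}_0}(c,b)}$ (binomial series), and its coefficients $\tau^{(b,c)}(k{\bf n}_0)$ are defined by $f_{{\bf n}_0}=1+\sum_{k\ge1}\tau^{(b,c)}(k{\bf n}_0)\hat{\bf y}^{k{\bf n}_0}$. -}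

module Defs where

open import Data.Nat as ℕ using (ℕ; zero; suc; _≡ᵇ_)
open import Data.Nat.GCD using (gcd)
open import Data.Integer as ℤ using (ℤ; +_)
open import Data.Rational as ℚ using (ℚ; 0ℚ; 1ℚ)
open import Data.Product using (_×_; _,_)
open import Data.Sum using (_⊎_)
open import Data.Bool using (if_then_else_; _∧_)
open import Data.List using (List; []; _∷_; foldr; map; concatMap; upTo)
open import Data.List.Relation.Unary.AllPairs using (AllPairs)
open import Data.List.Membership.Propositional using (_∈_)
open import Relation.Binary.PropositionalEquality using (_≡_; _≢_)
open import Function using (_⇔_)

Vec2 : Set
Vec2 = ℕ × ℕ

NPlus : Vec2 → Set
NPlus n = n ≢ (0 , 0)

deg : Vec2 → ℕ
deg (n₁ , n₂) = n₁ ℕ.+ n₂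

scale : ℕ → Vec2 → Vec2
scale k (n₁ , n₂) = (k ℕ.* n₁ , k ℕ.* n₂)

br : Vec2 → Vec2 → ℤ
br (a₁ , a₂) (b₁ , b₂) = (+ (a₁ ℕ.* b₂)) ℤ.- (+ (a₂ ℕ.* b₁))

-- a / d as a rational (d = 0 never occurs in uses below; it is sent to 0)
frac : ℤ → ℕ → ℚ
frac a zero    = 0ℚ
frac a (suc d) = a ℚ./ suc d

fromℕ : ℕ → ℚ
fromℕ n = frac (+ n) 1

sumTo : ℕ → (ℕ → ℚ) → ℚ
sumTo zero    g = g 0
sumTo (suc n) g = sumTo n g ℚ.+ g (suc n)

sum1To : ℕ → (ℕ → ℚ) → ℚ
sum1To zero    g = 0ℚ
sum1To (suc n) g = sum1To n g ℚ.+ g (suc n)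

factorial : ℕ → ℕ
factorial zero    = 1
factorial (suc n) = suc n ℕ.* factorial n

binom : ℚ → ℕ → ℚ
binom x zero    = 1ℚ
binom x (suc k) = binom x k ℚ.* (x ℚ.- fromℕ k) ℚ.* frac (+ 1) (suc k)

signPow : ℕ → ℚ
signPow zero    = ℚ.- 1ℚ
signPow (suc j) = ℚ.- signPow j

-- The Lie algebra ĝ = Π_{n ∈ N^+} ℚ X_n : an element is its coefficient
-- function (value at (0,0) unused / zero).  The pro-unipotent group
-- G = exp ĝ is realised through its faithful action on ℚ[[x₁,x₂]]:
-- X_p acts as the derivation  x^q ↦ {p , q} x^(p+q)  (a Lie algebra
-- homomorphism, injective on ĝ), and exp(A) acts as Σ_k D_A^k / k!.

Series : Set
Series = ℕ → ℕ → ℚ            -- coefficient of x₁^m₁ x₂^m₂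

LieElt : Set
LieElt = ℕ → ℕ → ℚ            -- coefficient of X_(p₁,p₂)

deriv : LieElt → Series → Series
deriv A f m₁ m₂ =
  sumTo m₁ λ p₁ → sumTo m₂ λ p₂ →
    A p₁ p₂ ℚ.* frac (br (p₁ , p₂) (m₁ ℕ.∸ p₁ , m₂ ℕ.∸ p₂)) 1
            ℚ.* f (m₁ ℕ.∸ p₁) (m₂ ℕ.∸ p₂)

derivPow : ℕ → LieElt → Series → Series
derivPow zero    A f = f
derivPow (suc k) A f = deriv A (derivPow k A f)

-- action of exp(A) (A supported in degree ≥ 1, so D_A^k f has no
-- coefficient in degree < k and the sum is finite at each monomial)
expAct : LieElt → Series → Series
expAct A f m₁ m₂ =
  sumTo (m₁ ℕ.+ m₂) λ k → derivPow k A f m₁ m₂ ℚ.* frac (+ 1) (factorial k)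

-- s Σ_{j ≥ 1} (-1)^(j+1)/j² X_{j n}   (log of Ψ[n]^s)
psiLie : ℚ → Vec2 → LieElt
psiLie s (n₁ , n₂) p₁ p₂ =
  sum1To (p₁ ℕ.+ p₂) λ j →
    if (p₁ ≡ᵇ j ℕ.* n₁) ∧ (p₂ ≡ᵇ j ℕ.* n₂)
    then s ℚ.* signPow j ℚ.* frac (+ 1) (j ℕ.* j)
    else 0ℚ

Psi : ℚ → Vec2 → Series → Series
Psi s n = expAct (psiLie s n)

-- the order of factors: Ψ[n] may stand left of Ψ[n'] iff
-- {n,n'} > 0, or {n,n'} = 0 and deg n < deg n'
Before : Vec2 → Vec2 → Set
Before n n' = (ℤ.+ 0 ℤ.< br n n') ⊎ ((br n n' ≡ ℤ.+ 0) × (deg n ℕ.< deg n'))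

ordProd : (Vec2 → ℚ) → List Vec2 → Series → Series
ordProd u L f = foldr (λ n g → Psi (u n) n g) f L

EnumDeg : ℕ → List Vec2 → Set
EnumDeg D L = ∀ n → (n ∈ L) ⇔ (NPlus n × deg n ℕ.≤ D)

-- u is the exponent family of the factorisation
--   Ψ[(0,1)]^b Ψ[(1,0)]^c = ordered Π_{n ∈ N^+} Ψ[n]^{u n}.
-- Modulo terms of degree > D only the factors with deg n ≤ D matter,
-- so the identity is tested on every coefficient of degree ≤ D, using the
-- (unique) correctly ordered list of those factors.
IsFactorization : ℕ → ℕ → (Vec2 → ℚ) → Set
IsFactorization b c u =
  ∀ (D : ℕ) (L : List Vec2) → EnumDeg D L → AllPairs Before L →
  ∀ (f : Series) (m₁ m₂ : ℕ) → m₁ ℕ.+ m₂ ℕ.≤ D →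
  Psi (fromℕ b) (0 , 1) (Psi (fromℕ c) (1 , 0) f) m₁ m₂ ≡ ordProd u L f m₁ m₂

gcdN : Vec2 → ℕ
gcdN (n₁ , n₂) = gcd n₁ n₂

gcdBC : ℕ → ℕ → Vec2 → ℕ
gcdBC b c (n₁ , n₂) = gcd (n₁ ℕ.* b) (n₂ ℕ.* c)

delta : ℕ → ℕ → Vec2 → ℚ
delta b c n = frac (+ (b ℕ.* c)) (gcdBC b c n)

deltaInv : ℕ → ℕ → Vec2 → ℚ
deltaInv b c n = frac (+ gcdBC b c n) (b ℕ.* c)

gFun : ℕ → ℕ → Vec2 → ℚ
gFun b c n = frac (+ gcdBC b c n) (gcdN n)

UFun : ℕ → ℕ → (Vec2 → ℚ) → Vec2 → ℚ
UFun b c u n = frac (+ gcdN n) (b ℕ.* c) ℚ.* u n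

uHat : ℕ → ℕ → (Vec2 → ℚ) → Vec2 → ℚ
uHat b c u n = deltaInv b c n ℚ.* u n

-- wall function  f_{n₀} = Π_{j≥1} (1 + t^j)^{û_{j n₀}}  with t = ŷ^{n₀}
-- (one-variable power series in t; ŷ^{k n₀} ↔ t^k)

Series1 : Set
Series1 = ℕ → ℚ

one1 : Series1
one1 zero    = 1ℚ
one1 (suc _) = 0ℚ

mul1 : Series1 → Series1 → Series1
mul1 f g r = sumTo r λ i → f i ℚ.* g (r ℕ.∸ i)

binomPow : ℚ → ℕ → Series1
binomPow a j r = sumTo r λ i → if (i ℕ.* j) ≡ᵇ r then binom a i else 0ℚ

-- factors j = 1 .. k (factors with j > k are ≡ 1 mod t^(k+1))
wallTrunc : ℕ → ℕ → (Vec2 → ℚ) → Vec2 → ℕ → Series1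
wallTrunc b c u n₀ zero    = one1
wallTrunc b c u n₀ (suc j) =
  mul1 (wallTrunc b c u n₀ j) (binomPow (uHat b c u (scale (suc j) n₀)) (suc j))

-- τ^{(b,c)}(k n₀) = coefficient of ŷ^{k n₀} in f_{n₀}
tau : ℕ → ℕ → (Vec2 → ℚ) → Vec2 → ℕ → ℚ
tau b c u n₀ k = wallTrunc b c u n₀ k k

-- right-hand side: sum over (s₁,…,s_k) ∈ ℕ^k with Σ j s_j = k
-- (each such s_j ≤ k, so enumerating entries in 0..k is exhaustive)

tuples : ℕ → ℕ → List (List ℕ)
tuples zero    B = [] ∷ []
tuples (suc l) B = concatMap (λ x → map (x ∷_) (tuples l B)) (upTo (suc B))

wsum : ℕ → List ℕ → ℕ
wsum j []       = 0
wsum j (s ∷ ss) = j ℕ.* s ℕ.+ wsum (suc j) ss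

sumList : List ℚ → ℚ
sumList = foldr ℚ._+_ 0ℚ

termProd : ℕ → ℕ → (Vec2 → ℚ) → Vec2 → ℕ → List ℕ → ℚ
termProd b c u n₀ j []       = 1ℚ
termProd b c u n₀ j (s ∷ ss) =
  binom (gFun b c n₀ ℚ.* UFun b c u (scale j n₀)) s ℚ.* termProd b c u n₀ (suc j) ss

rhsSum : ℕ → ℕ → (Vec2 → ℚ) → Vec2 → ℕ → ℚ
rhsSum b c u n₀ k =
  sumList (map (λ s → if wsum 1 s ≡ᵇ k then termProd b c u n₀ 1 s else 0ℚ)
               (tuples k k))

-- Along a primitive ray n₀ both gcds in the definitions scale linearly in j:
-- gcd(j n₁, j n₂) = j and gcd(j n₁ b, j n₂ c) = j gcd(n₁ b, n₂ c), so that
-- g(n₀) U_{j n₀} = û_{j n₀}.  The right-hand side is then the coefficient of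
-- t^k in Π_{j ≤ k} (1 + t^j)^{û_{j n₀}}, each factor expanded by the binomial
-- series: choosing the term t^{j s_j} of the j-th factor contributes
-- binom(û_{j n₀}, s_j), and multiplying by one more factor appends one entry
-- to the tuple (s_1, …, s_j).  This holds for every exponent family u.

module Submission where

open import Defs
open import Data.Nat using (ℕ; _≤_)
open import Data.Nat.GCD using (gcd)
open import Data.Rational using (ℚ)
open import Data.Product using (_,_)
open import Relation.Binary.PropositionalEquality using (_≡_)

open import Algebra.Bundles using (CommutativeMonoid)
open import Data.Bool using (Bool; true; false; if_then_else_)
import Data.Integer as ℤ
open import Data.List using (List; []; _∷_; _++_; map; concatMap; upTo; length)
import Data.List.Properties as List
open import Data.Nat as ℕ using (zero; suc; _∸_; _≡ᵇ_; _≤′_; ≤′-refl; ≤′-step; z≤n; s≤s)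
import Data.Nat.GCD as ℕ
import Data.Nat.Properties as ℕ
import Data.Integer.Properties as ℤ
open import Data.Rational using (_+_; _*_; 0ℚ; 1ℚ; fromℚᵘ)
import Data.Rational.Properties as ℚ
open import Data.Rational.Unnormalised as ℚᵘ using (mkℚᵘ)
import Data.Rational.Unnormalised.Properties as ℚᵘ
open import Function using (_∘_)
open import Relation.Nullary using (Dec; yes; no)
open import Relation.Nullary.Decidable using (dec-true; dec-false)
open import Relation.Binary.PropositionalEquality
  using (_≢_; refl; sym; trans; cong; cong₂; subst; module ≡-Reasoning)

open import Algebra.Properties.CommutativeSemigroup
  (CommutativeMonoid.commutativeSemigroup ℚ.+-0-commutativeMonoid) using (interchange)

open ≡-Reasoning

∑ : {A : Set} → List A → (A → ℚ) → ℚ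
∑ xs f = sumList (map f xs)

syntax ∑ xs (λ x → e) = ∑[ x ← xs ] e

module _ {A : Set} where

  ∑-cong : (xs : List A) {f g : A → ℚ} → (∀ x → f x ≡ g x) → ∑ xs f ≡ ∑ xs g
  ∑-cong []       f≗g = refl
  ∑-cong (x ∷ xs) f≗g = cong₂ _+_ (f≗g x) (∑-cong xs f≗g)

  ∑-++ : (xs ys : List A) (f : A → ℚ) → ∑ (xs ++ ys) f ≡ ∑ xs f + ∑ ys f
  ∑-++ []       ys f = sym (ℚ.+-identityˡ (∑ ys f))
  ∑-++ (x ∷ xs) ys f = trans (cong (f x +_) (∑-++ xs ys f)) (sym (ℚ.+-assoc (f x) _ _))

  ∑-zero : (xs : List A) → ∑[ x ← xs ] 0ℚ ≡ 0ℚ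
  ∑-zero []       = refl
  ∑-zero (x ∷ xs) = trans (ℚ.+-identityˡ _) (∑-zero xs)

  ∑-+ : (xs : List A) (f g : A → ℚ) → ∑[ x ← xs ] (f x + g x) ≡ ∑ xs f + ∑ xs g
  ∑-+ []       f g = sym (ℚ.+-identityˡ 0ℚ)
  ∑-+ (x ∷ xs) f g = trans (cong (f x + g x +_) (∑-+ xs f g)) (interchange (f x) (g x) _ _)

  ∑-*ˡ : (xs : List A) (p : ℚ) (f : A → ℚ) → p * ∑ xs f ≡ ∑[ x ← xs ] (p * f x)
  ∑-*ˡ []       p f = ℚ.*-zeroʳ p
  ∑-*ˡ (x ∷ xs) p f = trans (ℚ.*-distribˡ-+ p (f x) _) (cong (p * f x +_) (∑-*ˡ xs p f))

  ∑-*ʳ : (xs : List A) (p : ℚ) (f : A → ℚ) → ∑ xs f * p ≡ ∑[ x ← xs ] (f x * p)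
  ∑-*ʳ []       p f = ℚ.*-zeroˡ p
  ∑-*ʳ (x ∷ xs) p f = trans (ℚ.*-distribʳ-+ p (f x) _) (cong (f x * p +_) (∑-*ʳ xs p f))

module _ {A B : Set} where

  ∑-map : (h : A → B) (xs : List A) (f : B → ℚ) → ∑ (map h xs) f ≡ ∑ xs (f ∘ h)
  ∑-map h xs f = cong sumList (sym (List.map-∘ xs))

  ∑-concatMap : (h : A → List B) (xs : List A) (f : B → ℚ) →
    ∑ (concatMap h xs) f ≡ ∑[ x ← xs ] ∑ (h x) f
  ∑-concatMap h []       f = refl
  ∑-concatMap h (x ∷ xs) f =
    trans (∑-++ (h x) (concatMap h xs) f) (cong (∑ (h x) f +_) (∑-concatMap h xs f))

  ∑-comm : (xs : List A) (ys : List B) (F : A → B → ℚ) →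
    ∑[ x ← xs ] ∑[ y ← ys ] F x y ≡ ∑[ y ← ys ] ∑[ x ← xs ] F x y
  ∑-comm []       ys F = sym (∑-zero ys)
  ∑-comm (x ∷ xs) ys F =
    trans (cong (∑ ys (F x) +_) (∑-comm xs ys F)) (sym (∑-+ ys (F x) (λ y → ∑[ x′ ← xs ] F x′ y)))

  ∑-*-∑ : (xs : List A) (ys : List B) (f : A → ℚ) (g : B → ℚ) →
    ∑ xs f * ∑ ys g ≡ ∑[ x ← xs ] ∑[ y ← ys ] (f x * g y)
  ∑-*-∑ xs ys f g = trans (∑-*ʳ xs (∑ ys g) f) (∑-cong xs (λ x → ∑-*ˡ ys (f x) g))

sumTo≡∑upTo : ∀ n (f : ℕ → ℚ) → sumTo n f ≡ ∑ (upTo (suc n)) f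
sumTo≡∑upTo zero    f = sym (ℚ.+-identityʳ (f 0))
sumTo≡∑upTo (suc n) f = begin
  sumTo n f + f (suc n)                    ≡⟨ cong₂ _+_ (sumTo≡∑upTo n f) (sym (ℚ.+-identityʳ _)) ⟩
  ∑ (upTo (suc n)) f + ∑ (suc n ∷ []) f    ≡⟨ ∑-++ (upTo (suc n)) (suc n ∷ []) f ⟨
  ∑ (upTo (suc n) ++ suc n ∷ []) f         ≡⟨ cong (λ xs → ∑ xs f) (List.upTo-∷ʳ (suc n)) ⟩
  ∑ (upTo (suc (suc n))) f                 ∎

sumTo-∑-comm : {A : Set} (r : ℕ) (xs : List A) (F : ℕ → A → ℚ) →
  sumTo r (λ i → ∑[ x ← xs ] F i x) ≡ ∑[ x ← xs ] sumTo r (λ i → F i x)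
sumTo-∑-comm r xs F = begin
  sumTo r (λ i → ∑[ x ← xs ] F i x)                 ≡⟨ sumTo≡∑upTo r _ ⟩
  ∑[ i ← upTo (suc r) ] ∑[ x ← xs ] F i x           ≡⟨ ∑-comm (upTo (suc r)) xs F ⟩
  ∑[ x ← xs ] ∑[ i ← upTo (suc r) ] F i x           ≡⟨ ∑-cong xs (λ x → sumTo≡∑upTo r (λ i → F i x)) ⟨
  ∑[ x ← xs ] sumTo r (λ i → F i x)                 ∎

sumTo-cong : ∀ n {f g : ℕ → ℚ} → (∀ i → i ≤ n → f i ≡ g i) → sumTo n f ≡ sumTo n g
sumTo-cong zero    f≗g = f≗g 0 z≤n
sumTo-cong (suc n) f≗g =
  cong₂ _+_ (sumTo-cong n (λ i i≤n → f≗g i (ℕ.m≤n⇒m≤1+n i≤n))) (f≗g (suc n) ℕ.≤-refl)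

sumTo-zero : ∀ n (f : ℕ → ℚ) → (∀ i → i ≤ n → f i ≡ 0ℚ) → sumTo n f ≡ 0ℚ
sumTo-zero n f f≗0 = trans (sumTo-cong n f≗0) (vanish n)
  where
  vanish : ∀ n → sumTo n (λ _ → 0ℚ) ≡ 0ℚ
  vanish zero    = refl
  vanish (suc n) = trans (ℚ.+-identityʳ _) (vanish n)

sumTo-extend : ∀ {m n} (f : ℕ → ℚ) → m ≤′ n → (∀ i → m ℕ.< i → f i ≡ 0ℚ) → sumTo m f ≡ sumTo n f
sumTo-extend f ≤′-refl            f≗0 = refl
sumTo-extend {m} f (≤′-step {n} m≤′n) f≗0 = begin
  sumTo m f              ≡⟨ sumTo-extend f m≤′n f≗0 ⟩
  sumTo n f              ≡⟨ ℚ.+-identityʳ (sumTo n f) ⟨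
  sumTo n f + 0ℚ         ≡⟨ cong (sumTo n f +_) (f≗0 (suc n) (s≤s (ℕ.≤′⇒≤ m≤′n))) ⟨
  sumTo n f + f (suc n)  ∎

sumTo-last : ∀ m (f : ℕ → ℚ) → (∀ i → i ℕ.< m → f i ≡ 0ℚ) → sumTo m f ≡ f m
sumTo-last zero    f f≗0 = refl
sumTo-last (suc m) f f≗0 =
  trans (cong (_+ f (suc m)) (sumTo-zero m f (λ i i≤m → f≗0 i (s≤s i≤m)))) (ℚ.+-identityˡ _)

sumTo-single : ∀ {m} n (f : ℕ → ℚ) → m ≤ n → (∀ i → i ≢ m → f i ≡ 0ℚ) → sumTo n f ≡ f m
sumTo-single {m} n f m≤n f≗0 = begin
  sumTo n f  ≡⟨ sumTo-extend f (ℕ.≤⇒≤′ m≤n) (λ i m<i → f≗0 i (ℕ.>⇒≢ m<i)) ⟨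
  sumTo m f  ≡⟨ sumTo-last m f (λ i i<m → f≗0 i (ℕ.<⇒≢ i<m)) ⟩
  f m        ∎

infixr 8 [_]·_
[_]·_ : Bool → ℚ → ℚ
[ B ]· p = if B then p else 0ℚ

*-[]· : ∀ B p q → p * ([ B ]· q) ≡ [ B ]· (p * q)
*-[]· true  p q = refl
*-[]· false p q = ℚ.*-zeroʳ p

≡ᵇ-refl : ∀ m → (m ≡ᵇ m) ≡ true
≡ᵇ-refl m = dec-true (m ℕ.≟ m) refl

≢⇒≡ᵇ-false : ∀ {m n} → m ≢ n → (m ≡ᵇ n) ≡ false
≢⇒≡ᵇ-false {m} {n} = dec-false (m ℕ.≟ n)

≡ᵇ-∸ : ∀ {m r} y → m ≤ r → (y ≡ᵇ r ∸ m) ≡ (m ℕ.+ y ≡ᵇ r)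
≡ᵇ-∸ y z≤n       = refl
≡ᵇ-∸ y (s≤s m≤r) = ≡ᵇ-∸ y m≤r

monomial : ℕ → ℚ → Series1
monomial m p i = [ m ≡ᵇ i ]· p

mul1-cong : ∀ {f f′ g g′ : Series1} r →
  (∀ i → i ≤ r → f i ≡ f′ i) → (∀ i → i ≤ r → g i ≡ g′ i) → mul1 f g r ≡ mul1 f′ g′ r
mul1-cong r f≗f′ g≗g′ =
  sumTo-cong r (λ i i≤r → cong₂ _*_ (f≗f′ i i≤r) (g≗g′ (r ∸ i) (ℕ.m∸n≤m r i)))

mul1-monomial : ∀ m n p q r → mul1 (monomial m p) (monomial n q) r ≡ monomial (m ℕ.+ n) (p * q) r
mul1-monomial m n p q r = by-cases (m ℕ.≤? r)
  where
  term : ℕ → ℚ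
  term i = monomial m p i * monomial n q (r ∸ i)

  off-diagonal : ∀ i → i ≢ m → term i ≡ 0ℚ
  off-diagonal i i≢m =
    trans (cong (λ B → ([ B ]· p) * monomial n q (r ∸ i)) (≢⇒≡ᵇ-false (i≢m ∘ sym)))
          (ℚ.*-zeroˡ (monomial n q (r ∸ i)))

  by-cases : Dec (m ≤ r) → sumTo r term ≡ monomial (m ℕ.+ n) (p * q) r
  by-cases (yes m≤r) = begin
    sumTo r term                  ≡⟨ sumTo-single r term m≤r off-diagonal ⟩
    term m                        ≡⟨ cong (λ B → ([ B ]· p) * monomial n q (r ∸ m)) (≡ᵇ-refl m) ⟩
    p * ([ n ≡ᵇ r ∸ m ]· q)       ≡⟨ *-[]· _ p q ⟩
    [ n ≡ᵇ r ∸ m ]· (p * q)       ≡⟨ cong ([_]· (p * q)) (≡ᵇ-∸ n m≤r) ⟩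
    monomial (m ℕ.+ n) (p * q) r  ∎
  by-cases (no m≰r) = begin
    sumTo r term                  ≡⟨ sumTo-zero r term (λ i i≤r → off-diagonal i (λ { refl → m≰r i≤r })) ⟩
    0ℚ                            ≡⟨ cong ([_]· (p * q)) (≢⇒≡ᵇ-false m+n≢r) ⟨
    monomial (m ℕ.+ n) (p * q) r  ∎
    where
    m+n≢r : m ℕ.+ n ≢ r
    m+n≢r m+n≡r = m≰r (subst (m ≤_) m+n≡r (ℕ.m≤m+n m n))

genSeries : {A : Set} → List A → (A → ℕ) → (A → ℚ) → Series1
genSeries xs w c r = ∑[ x ← xs ] monomial (w x) (c x) r

mul1-genSeries : {A B : Set} (xs : List A) (ys : List B)
  (v : A → ℕ) (w : B → ℕ) (c : A → ℚ) (d : B → ℚ) →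
  ∀ r → mul1 (genSeries xs v c) (genSeries ys w d) r ≡
        ∑[ x ← xs ] ∑[ y ← ys ] monomial (v x ℕ.+ w y) (c x * d y) r
mul1-genSeries {A} {B} xs ys v w c d r = begin
  sumTo r (λ i → genSeries xs v c i * genSeries ys w d (r ∸ i))
    ≡⟨ sumTo-cong r (λ i _ → ∑-*-∑ xs ys _ _) ⟩
  sumTo r (λ i → ∑[ x ← xs ] ∑[ y ← ys ] term x y i)
    ≡⟨ sumTo-∑-comm r xs _ ⟩
  ∑[ x ← xs ] sumTo r (λ i → ∑[ y ← ys ] term x y i)
    ≡⟨ ∑-cong xs (λ x → sumTo-∑-comm r ys (λ i y → term x y i)) ⟩
  ∑[ x ← xs ] ∑[ y ← ys ] sumTo r (term x y)
    ≡⟨ ∑-cong xs (λ x → ∑-cong ys (λ y → mul1-monomial (v x) (w y) (c x) (d y) r)) ⟩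
  ∑[ x ← xs ] ∑[ y ← ys ] monomial (v x ℕ.+ w y) (c x * d y) r ∎
  where
  term : A → B → ℕ → ℚ
  term x y i = monomial (v x) (c x) i * monomial (w y) (d y) (r ∸ i)

binomPow≡genSeries : ∀ a j {m B} → m ≤ B →
  binomPow a (suc j) m ≡ genSeries (upTo (suc B)) (λ i → i ℕ.* suc j) (binom a) m
binomPow≡genSeries a j {m} {B} m≤B =
  trans (sumTo-extend term (ℕ.≤⇒≤′ m≤B) vanish) (sumTo≡∑upTo B term)
  where
  term : ℕ → ℚ
  term i = monomial (i ℕ.* suc j) (binom a i) m
  vanish : ∀ i → m ℕ.< i → term i ≡ 0ℚ
  vanish i m<i = cong ([_]· binom a i)
    (≢⇒≡ᵇ-false (λ i*j≡m → ℕ.<⇒≱ m<i (subst (i ≤_) i*j≡m (ℕ.m≤m*n i (suc j)))))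

module _ (B : ℕ) where

  ∑-tuples-suc : ∀ l (F : List ℕ → ℚ) →
    ∑ (tuples (suc l) B) F ≡ ∑[ x ← upTo (suc B) ] ∑[ s ← tuples l B ] F (x ∷ s)
  ∑-tuples-suc l F = trans (∑-concatMap (λ x → map (x ∷_) (tuples l B)) (upTo (suc B)) F)
                           (∑-cong (upTo (suc B)) (λ x → ∑-map (x ∷_) (tuples l B) F))

  ∑-tuples-snoc : ∀ l (F : List ℕ → ℚ) →
    ∑ (tuples (suc l) B) F ≡ ∑[ s ← tuples l B ] ∑[ x ← upTo (suc B) ] F (s ++ x ∷ [])
  ∑-tuples-snoc zero    F = begin
    ∑ (tuples 1 B) F                              ≡⟨ ∑-tuples-suc zero F ⟩
    ∑[ x ← upTo (suc B) ] (F (x ∷ []) + 0ℚ)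
      ≡⟨ ∑-cong (upTo (suc B)) (λ x → ℚ.+-identityʳ (F (x ∷ []))) ⟩
    ∑[ x ← upTo (suc B) ] F (x ∷ [])              ≡⟨ ℚ.+-identityʳ _ ⟨
    ∑[ x ← upTo (suc B) ] F (x ∷ []) + 0ℚ         ∎
  ∑-tuples-snoc (suc l) F = begin
    ∑ (tuples (suc (suc l)) B) F
      ≡⟨ ∑-tuples-suc (suc l) F ⟩
    ∑[ y ← upTo (suc B) ] ∑[ s ← tuples (suc l) B ] F (y ∷ s)
      ≡⟨ ∑-cong (upTo (suc B)) (λ y → ∑-tuples-snoc l (λ s → F (y ∷ s))) ⟩
    ∑[ y ← upTo (suc B) ] ∑[ s ← tuples l B ] ∑[ x ← upTo (suc B) ] F (y ∷ s ++ x ∷ [])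
      ≡⟨ ∑-tuples-suc l (λ s → ∑[ x ← upTo (suc B) ] F (s ++ x ∷ [])) ⟨
    ∑[ s ← tuples (suc l) B ] ∑[ x ← upTo (suc B) ] F (s ++ x ∷ []) ∎

  ∑-tuples-cong : ∀ l {F G : List ℕ → ℚ} → (∀ s → length s ≡ l → F s ≡ G s) →
    ∑ (tuples l B) F ≡ ∑ (tuples l B) G
  ∑-tuples-cong zero    F≗G = cong (_+ 0ℚ) (F≗G [] refl)
  ∑-tuples-cong (suc l) {F} {G} F≗G = begin
    ∑ (tuples (suc l) B) F                               ≡⟨ ∑-tuples-suc l F ⟩
    ∑[ x ← upTo (suc B) ] ∑[ s ← tuples l B ] F (x ∷ s)
      ≡⟨ ∑-cong (upTo (suc B)) (λ x → ∑-tuples-cong l (λ s |s|≡l → F≗G (x ∷ s) (cong suc |s|≡l))) ⟩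
    ∑[ x ← upTo (suc B) ] ∑[ s ← tuples l B ] G (x ∷ s)  ≡⟨ ∑-tuples-suc l G ⟨
    ∑ (tuples (suc l) B) G                               ∎

wsum-snoc : ∀ j s x → wsum j (s ++ x ∷ []) ≡ wsum j s ℕ.+ x ℕ.* (j ℕ.+ length s)
wsum-snoc j []      x = begin
  j ℕ.* x ℕ.+ 0     ≡⟨ ℕ.+-identityʳ (j ℕ.* x) ⟩
  j ℕ.* x           ≡⟨ ℕ.*-comm j x ⟩
  x ℕ.* j           ≡⟨ cong (x ℕ.*_) (ℕ.+-identityʳ j) ⟨
  x ℕ.* (j ℕ.+ 0)   ∎
wsum-snoc j (y ∷ s) x = begin
  j ℕ.* y ℕ.+ wsum (suc j) (s ++ x ∷ [])
    ≡⟨ cong (j ℕ.* y ℕ.+_) (wsum-snoc (suc j) s x) ⟩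
  j ℕ.* y ℕ.+ (wsum (suc j) s ℕ.+ x ℕ.* (suc j ℕ.+ length s))
    ≡⟨ ℕ.+-assoc (j ℕ.* y) _ _ ⟨
  j ℕ.* y ℕ.+ wsum (suc j) s ℕ.+ x ℕ.* (suc j ℕ.+ length s)
    ≡⟨ cong (λ n → j ℕ.* y ℕ.+ wsum (suc j) s ℕ.+ x ℕ.* n) (ℕ.+-suc j (length s)) ⟨
  j ℕ.* y ℕ.+ wsum (suc j) s ℕ.+ x ℕ.* (j ℕ.+ suc (length s)) ∎

binomPowProd : (ℕ → ℚ) → ℕ → Series1
binomPowProd a zero    = one1
binomPowProd a (suc k) = mul1 (binomPowProd a k) (binomPow (a (suc k)) (suc k))

binomProdFrom : (ℕ → ℚ) → ℕ → List ℕ → ℚ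
binomProdFrom a j []       = 1ℚ
binomProdFrom a j (s ∷ ss) = binom (a j) s * binomProdFrom a (suc j) ss

binomProdFrom-snoc : ∀ a j s x →
  binomProdFrom a j (s ++ x ∷ []) ≡ binomProdFrom a j s * binom (a (j ℕ.+ length s)) x
binomProdFrom-snoc a j []      x = begin
  binom (a j) x * 1ℚ          ≡⟨ ℚ.*-identityʳ _ ⟩
  binom (a j) x               ≡⟨ cong (λ i → binom (a i) x) (ℕ.+-identityʳ j) ⟨
  binom (a (j ℕ.+ 0)) x       ≡⟨ ℚ.*-identityˡ _ ⟨
  1ℚ * binom (a (j ℕ.+ 0)) x  ∎
binomProdFrom-snoc a j (y ∷ s) x = begin
  binom (a j) y * binomProdFrom a (suc j) (s ++ x ∷ [])
    ≡⟨ cong (binom (a j) y *_) (binomProdFrom-snoc a (suc j) s x) ⟩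
  binom (a j) y * (binomProdFrom a (suc j) s * binom (a (suc j ℕ.+ length s)) x)
    ≡⟨ ℚ.*-assoc (binom (a j) y) _ _ ⟨
  binom (a j) y * binomProdFrom a (suc j) s * binom (a (suc j ℕ.+ length s)) x
    ≡⟨ cong (λ i → binom (a j) y * binomProdFrom a (suc j) s * binom (a i) x) (ℕ.+-suc j (length s)) ⟨
  binom (a j) y * binomProdFrom a (suc j) s * binom (a (j ℕ.+ suc (length s))) x ∎

binomPowProd≡genSeries : ∀ a k {B r} → r ≤ B →
  binomPowProd a k r ≡ genSeries (tuples k B) (wsum 1) (binomProdFrom a 1) r
binomPowProd≡genSeries a zero    {r = zero}  _ = sym (ℚ.+-identityʳ 1ℚ)
binomPowProd≡genSeries a zero    {r = suc _} _ = sym (ℚ.+-identityʳ 0ℚ)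
binomPowProd≡genSeries a (suc k) {B} {r} r≤B = begin
  mul1 (binomPowProd a k) (binomPow (a (suc k)) (suc k)) r
    ≡⟨ mul1-cong r (λ i i≤r → binomPowProd≡genSeries a k (ℕ.≤-trans i≤r r≤B))
                   (λ i i≤r → binomPow≡genSeries (a (suc k)) k (ℕ.≤-trans i≤r r≤B)) ⟩
  mul1 (genSeries T (wsum 1) P) (genSeries U (λ x → x ℕ.* suc k) (binom (a (suc k)))) r
    ≡⟨ mul1-genSeries T U (wsum 1) (λ x → x ℕ.* suc k) P (binom (a (suc k))) r ⟩
  ∑[ s ← T ] ∑[ x ← U ] monomial (wsum 1 s ℕ.+ x ℕ.* suc k) (P s * binom (a (suc k)) x) r
    ≡⟨ ∑-tuples-cong B k (λ s |s|≡k → ∑-cong U (λ x → sym (snoc s x |s|≡k))) ⟩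
  ∑[ s ← T ] ∑[ x ← U ] monomial (wsum 1 (s ++ x ∷ [])) (P (s ++ x ∷ [])) r
    ≡⟨ ∑-tuples-snoc B k (λ s → monomial (wsum 1 s) (P s) r) ⟨
  genSeries (tuples (suc k) B) (wsum 1) P r ∎
  where
  T : List (List ℕ)
  T = tuples k B
  U : List ℕ
  U = upTo (suc B)
  P : List ℕ → ℚ
  P = binomProdFrom a 1
  snoc : ∀ s x → length s ≡ k →
    monomial (wsum 1 (s ++ x ∷ [])) (P (s ++ x ∷ [])) r ≡
    monomial (wsum 1 s ℕ.+ x ℕ.* suc k) (P s * binom (a (suc k)) x) r
  snoc s x |s|≡k = cong₂ (λ w c → monomial w c r)
    (trans (wsum-snoc 1 s x) (cong (λ l → wsum 1 s ℕ.+ x ℕ.* suc l) |s|≡k))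
    (trans (binomProdFrom-snoc a 1 s x) (cong (λ l → P s * binom (a (suc l)) x) |s|≡k))

fromℚᵘ-homo-* : ∀ p q → fromℚᵘ (p ℚᵘ.* q) ≡ fromℚᵘ p * fromℚᵘ q
fromℚᵘ-homo-* p q = ℚ.toℚᵘ-injective (ℚᵘ.≃-trans (ℚ.toℚᵘ-fromℚᵘ (p ℚᵘ.* q))
  (ℚᵘ.≃-sym (ℚᵘ.≃-trans (ℚ.toℚᵘ-homo-* (fromℚᵘ p) (fromℚᵘ q))
                         (ℚᵘ.*-cong (ℚ.toℚᵘ-fromℚᵘ p) (ℚ.toℚᵘ-fromℚᵘ q)))))

frac-* : ∀ m n d → frac (ℤ.+ (m ℕ.* n)) d ≡ fromℕ m * frac (ℤ.+ n) d
frac-* m n zero    = sym (ℚ.*-zeroʳ (fromℕ m))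
frac-* m n (suc d) = begin
  fromℚᵘ (mkℚᵘ (ℤ.+ (m ℕ.* n)) d)
    ≡⟨ cong₂ (λ i e → fromℚᵘ (mkℚᵘ i e)) (ℤ.pos-* m n) (sym (ℕ.+-identityʳ d)) ⟩
  fromℚᵘ (mkℚᵘ (ℤ.+ m) 0 ℚᵘ.* mkℚᵘ (ℤ.+ n) d)
    ≡⟨ fromℚᵘ-homo-* (mkℚᵘ (ℤ.+ m) 0) (mkℚᵘ (ℤ.+ n) d) ⟩
  fromℕ m * frac (ℤ.+ n) (suc d) ∎

gcd-scale-coprime : ∀ {n₁ n₂} → gcd n₁ n₂ ≡ 1 → ∀ j → gcd (j ℕ.* n₁) (j ℕ.* n₂) ≡ j
gcd-scale-coprime {n₁} {n₂} coprime j = begin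
  gcd (j ℕ.* n₁) (j ℕ.* n₂) ≡⟨ ℕ.c*gcd[m,n]≡gcd[cm,cn] j n₁ n₂ ⟨
  j ℕ.* gcd n₁ n₂           ≡⟨ cong (j ℕ.*_) coprime ⟩
  j ℕ.* 1                   ≡⟨ ℕ.*-identityʳ j ⟩
  j                         ∎

gcdBC-scale : ∀ b c n₁ n₂ j → gcdBC b c (scale j (n₁ , n₂)) ≡ j ℕ.* gcdBC b c (n₁ , n₂)
gcdBC-scale b c n₁ n₂ j = begin
  gcd (j ℕ.* n₁ ℕ.* b) (j ℕ.* n₂ ℕ.* c)
    ≡⟨ cong₂ gcd (ℕ.*-assoc j n₁ b) (ℕ.*-assoc j n₂ c) ⟩
  gcd (j ℕ.* (n₁ ℕ.* b)) (j ℕ.* (n₂ ℕ.* c))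
    ≡⟨ ℕ.c*gcd[m,n]≡gcd[cm,cn] j (n₁ ℕ.* b) (n₂ ℕ.* c) ⟨
  j ℕ.* gcd (n₁ ℕ.* b) (n₂ ℕ.* c) ∎

gFun*UFun≡uHat : ∀ b c u {n₁ n₂} → gcd n₁ n₂ ≡ 1 → ∀ j →
  gFun b c (n₁ , n₂) * UFun b c u (scale j (n₁ , n₂)) ≡ uHat b c u (scale j (n₁ , n₂))
gFun*UFun≡uHat b c u {n₁} {n₂} coprime j = begin
  frac (ℤ.+ G) (gcd n₁ n₂) * (frac (ℤ.+ gcd (j ℕ.* n₁) (j ℕ.* n₂)) (b ℕ.* c) * v)
    ≡⟨ cong₂ (λ d m → frac (ℤ.+ G) d * (frac (ℤ.+ m) (b ℕ.* c) * v))
             coprime (gcd-scale-coprime coprime j) ⟩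
  fromℕ G * (frac (ℤ.+ j) (b ℕ.* c) * v)
    ≡⟨ ℚ.*-assoc (fromℕ G) (frac (ℤ.+ j) (b ℕ.* c)) v ⟨
  fromℕ G * frac (ℤ.+ j) (b ℕ.* c) * v
    ≡⟨ cong (_* v) (frac-* G j (b ℕ.* c)) ⟨
  frac (ℤ.+ (G ℕ.* j)) (b ℕ.* c) * v
    ≡⟨ cong (λ m → frac (ℤ.+ m) (b ℕ.* c) * v)
            (trans (ℕ.*-comm G j) (sym (gcdBC-scale b c n₁ n₂ j))) ⟩
  uHat b c u (scale j (n₁ , n₂)) ∎
  where
  G : ℕ
  G = gcdBC b c (n₁ , n₂)
  v : ℚ
  v = u (scale j (n₁ , n₂))

wallExponent : ℕ → ℕ → (Vec2 → ℚ) → Vec2 → ℕ → ℚ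
wallExponent b c u n₀ j = uHat b c u (scale j n₀)

wallTrunc≡binomPowProd : ∀ b c u n₀ k r →
  wallTrunc b c u n₀ k r ≡ binomPowProd (wallExponent b c u n₀) k r
wallTrunc≡binomPowProd b c u n₀ zero    r = refl
wallTrunc≡binomPowProd b c u n₀ (suc k) r =
  mul1-cong {g = binomPow (wallExponent b c u n₀ (suc k)) (suc k)} r
    (λ i _ → wallTrunc≡binomPowProd b c u n₀ k i) (λ _ _ → refl)

termProd≡binomProdFrom : ∀ b c u {n₁ n₂} → gcd n₁ n₂ ≡ 1 → ∀ j s →
  termProd b c u (n₁ , n₂) j s ≡ binomProdFrom (wallExponent b c u (n₁ , n₂)) j s
termProd≡binomProdFrom b c u coprime j []      = refl
termProd≡binomProdFrom b c u coprime j (x ∷ s) =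
  cong₂ (λ e p → binom e x * p) (gFun*UFun≡uHat b c u coprime j)
                                (termProd≡binomProdFrom b c u coprime (suc j) s)

lemma3p2 : (b c : ℕ) → 1 ≤ b → 1 ≤ c →
    (u : Vec2 → ℚ) → IsFactorization b c u →
    (n₁ n₂ : ℕ) → gcd n₁ n₂ ≡ 1 →
    (k : ℕ) → 1 ≤ k →
    tau b c u (n₁ , n₂) k ≡ rhsSum b c u (n₁ , n₂) k
lemma3p2 b c _ _ u _ n₁ n₂ coprime k _ = begin
  tau b c u (n₁ , n₂) k
    ≡⟨ wallTrunc≡binomPowProd b c u (n₁ , n₂) k k ⟩
  binomPowProd a k k
    ≡⟨ binomPowProd≡genSeries a k ℕ.≤-refl ⟩
  genSeries (tuples k k) (wsum 1) (binomProdFrom a 1) k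
    ≡⟨ ∑-cong (tuples k k) (λ s →
         cong ([ wsum 1 s ≡ᵇ k ]·_) (termProd≡binomProdFrom b c u coprime 1 s)) ⟨
  rhsSum b c u (n₁ , n₂) k ∎
  where
  a : ℕ → ℚ
  a = wallExponent b c u (n₁ , n₂)
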